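{- Let $A$ and $B$ be integral domains and $\varphi:A\to B$ a ring morphism. The set $M_A^{\varphi}=\{P\in M_A:\varphi(P(0))\ne0\}$ is stable under $\ast$, and $\varphi$ (applied coefficientwise) induces a monoid morphism $\varphi:M_A^{\varphi}\to M_B$. Furthermore, for $P\in M_A^{\varphi}$ and $r\ge1$, one has $P^{(r)}\in M_A^{\varphi}$ and $(\varphi(P))^{(r)}=\varphi(P^{(r)})$.
   Context: For an integral domain $A$, $M_A$ is the set of monic $P\in A[X]$ with $P(0)\ne0$, with the commutative monoid law $(P\ast Q)(X)=\mathrm{Res}_Z\big(P(Z),Q(X/Z)Z^{\deg Q}\big)$ (neutral element $X-1$; roots of $P\ast Q$ are the products of a root of $P$ and a root of $Q$, with multiplicity). For $r\ge1$, $P^{(r)}\in M_A$ is the unique polynomial with $P^{(r)}(X^r)=(P\ast(X^r-1))(X)$; its roots are the $r$-th powers of the roots of $P$. -}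

module Defs where

open import Level using (Level; _⊔_)
open import Algebra.Bundles using (CommutativeRing)
open import Algebra.Morphism.Structures using (module RingMorphisms)
open import Data.Nat using (ℕ; zero; suc)
import Data.Nat as ℕ
open import Data.Fin using (Fin; toℕ; punchIn)
import Data.Fin as Fin
open import Data.List using (List; []; _∷_; [_]; length; map; replicate; _++_)
open import Data.Bool using (Bool; true; false; not; if_then_else_)
open import Data.Product using (_×_; Σ)
open import Data.Sum using (_⊎_)
open import Relation.Nullary using (¬_; yes; no)

private variable
  a ℓa b ℓb : Level

record IsIntegralDomain (R : CommutativeRing a ℓa) : Set (a ⊔ ℓa) where
  open CommutativeRing R
  field
    1≉0            : ¬ (1# ≈ 0#)
    noZeroDivisors : ∀ x y → x * y ≈ 0# → (x ≈ 0#) ⊎ (y ≈ 0#)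

IsRingMorphism : (A : CommutativeRing a ℓa) (B : CommutativeRing b ℓb) →
                 (CommutativeRing.Carrier A → CommutativeRing.Carrier B) → Set _
IsRingMorphism A B φ =
  RingMorphisms.IsRingHomomorphism (CommutativeRing.rawRing A) (CommutativeRing.rawRing B) φ

module Poly (R : CommutativeRing a ℓa) where
  open CommutativeRing R

  -- A polynomial is a list of coefficients, lowest degree first
  -- (trailing zeros allowed; equality is coefficientwise).
  Pol : Set a
  Pol = List Carrier

  coeff : Pol → ℕ → Carrier
  coeff []       _       = 0#
  coeff (c ∷ _)  zero    = c
  coeff (_ ∷ cs) (suc i) = coeff cs i

  _≋_ : Pol → Pol → Set ℓa
  P ≋ Q = ∀ i → coeff P i ≈ coeff Q i

  _+ₚ_ : Pol → Pol → Pol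
  []       +ₚ Q        = Q
  P        +ₚ []       = P
  (x ∷ P)  +ₚ (y ∷ Q)  = (x + y) ∷ (P +ₚ Q)

  -ₚ_ : Pol → Pol
  -ₚ P = map -_ P

  scale : Carrier → Pol → Pol
  scale c P = map (c *_) P

  _*ₚ_ : Pol → Pol → Pol
  []      *ₚ Q = []
  (x ∷ P) *ₚ Q = scale x Q +ₚ (0# ∷ (P *ₚ Q))

  0ₚ 1ₚ : Pol
  0ₚ = []
  1ₚ = [ 1# ]

  const : Carrier → Pol
  const c = [ c ]

  monomial : Carrier → ℕ → Pol
  monomial c k = replicate k 0# ++ [ c ]

  sumFin : ∀ n → (Fin n → Pol) → Pol
  sumFin zero    f = 0ₚ
  sumFin (suc n) f = f Fin.zero +ₚ sumFin n (λ j → f (Fin.suc j))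

  isEven : ℕ → Bool
  isEven zero    = true
  isEven (suc k) = not (isEven k)

  signed : ℕ → Pol → Pol
  signed k P = if isEven k then P else (-ₚ P)

  det : ∀ n → (Fin n → Fin n → Pol) → Pol
  det zero    M = 1ₚ
  det (suc n) M = sumFin (suc n) λ j →
    signed (toℕ j) (M Fin.zero j *ₚ det n (λ i k → M (Fin.suc i) (punchIn j k)))

  -- Sylvester resultant of f = Σ_{i≤n} f_i Z^i and g = Σ_{j≤m} g_j Z^j
  -- (coefficient functions over R[X], formal degrees n and m):
  -- rows k < m : entry (k , c) = f_{n-(c-k)} if 0 ≤ c-k ≤ n, else 0;
  -- rows m + k : entry (m+k , c) = g_{m-(c-k)} if 0 ≤ c-k ≤ m, else 0.
  band : (ℕ → Pol) → ℕ → ℕ → ℕ → Pol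
  band h d k c with k ℕ.≤? c
  ... | no _ = 0ₚ
  ... | yes _ with (c ℕ.∸ k) ℕ.≤? d
  ...   | yes _ = h (d ℕ.∸ (c ℕ.∸ k))
  ...   | no _  = 0ₚ

  sylvester : (f : ℕ → Pol) (n : ℕ) (g : ℕ → Pol) (m : ℕ) → Fin (m ℕ.+ n) → Fin (m ℕ.+ n) → Pol
  sylvester f n g m i c with toℕ i ℕ.<? m
  ... | yes _ = band f n (toℕ i) (toℕ c)
  ... | no _  = band g m (toℕ i ℕ.∸ m) (toℕ c)

  Res : (f : ℕ → Pol) (n : ℕ) (g : ℕ → Pol) (m : ℕ) → Pol
  Res f n g m = det (m ℕ.+ n) (sylvester f n g m)

  -- Monic polynomials: a monic P of degree n is represented by the list
  -- of its n lower coefficients  [p_0, …, p_{n-1}],  P = p_0 + … + p_{n-1}X^{n-1} + X^n.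
  Monic : Set a
  Monic = List Carrier

  deg : Monic → ℕ
  deg = length

  toPol : Monic → Pol
  toPol P = P ++ [ 1# ]

  at0 : Monic → Carrier
  at0 P = coeff (toPol P) 0

  InM : Monic → Set ℓa
  InM P = ¬ (at0 P ≈ 0#)

  X-1 : Monic
  X-1 = [ - 1# ]

  Xr-1 : ℕ → Monic
  Xr-1 zero    = []
  Xr-1 (suc r) = (- 1#) ∷ replicate r 0#

  -- (P ∗ Q)(X) = Res_Z ( P(Z) , Q(X/Z) Z^{deg Q} ), an element of R[X].
  -- As a polynomial in Z, P(Z) has constant coefficients p_i, and
  -- Q(X/Z) Z^m (m = deg Q) has Z^k-coefficient q_{m-k} X^{m-k}.
  _∗_ : Monic → Monic → Pol
  P ∗ Q = Res (λ i → const (coeff (toPol P) i)) (deg P)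
              (λ k → monomial (coeff (toPol Q) (deg Q ℕ.∸ k)) (deg Q ℕ.∸ k)) (deg Q)

  substXr : ℕ → Pol → Pol
  substXr r S = go S
    where
    go : Pol → Pol
    go []       = []
    go (c ∷ cs) = c ∷ (replicate (r ℕ.∸ 1) 0# ++ go cs)

  -- S is the polynomial P^{(r)}:  S(X^r) = (P ∗ (X^r - 1))(X)
  IsPower : ℕ → Monic → Monic → Set ℓa
  IsPower r P S = substXr r (toPol S) ≋ (P ∗ (Xr-1 r))

module _ (A : CommutativeRing a ℓa) (B : CommutativeRing b ℓb)
         (φ : CommutativeRing.Carrier A → CommutativeRing.Carrier B) where
  private
    module A = CommutativeRing A
    module B = CommutativeRing B
    module PA = Poly A
    module PB = Poly B

  φMonic : PA.Monic → PB.Monic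
  φMonic = map φ

  φPol : PA.Pol → PB.Pol
  φPol = map φ

  InMφ : PA.Monic → Set (ℓa ⊔ ℓb)
  InMφ P = PA.InM P × ¬ (φ (PA.at0 P) B.≈ B.0#)

-- P ∗ Q is by definition the determinant (Laplace expansion along the first
-- row) of the Sylvester matrix S(P,Q) over R[X].  We prove three facts about
-- such determinants for general matrices and then check their hypotheses on
-- S(P,Q): (1) degree bounds on the entries, given by row and column weights,
-- bound the degree of det and fix its leading coefficient, so P ∗ Q is monic
-- of degree deg P · deg Q; (2) over an integral domain, a matrix with the
-- shape of S(P,Q) at X = 0 has nonzero constant term, so (P ∗ Q)(0) ≠ 0;
-- (3) entries supported on multiples of d give a determinant supported on
-- multiples of d, so P ∗ (X^r - 1) is a polynomial in X^r.  A ring morphism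
-- commutes with the polynomial operations, hence with det and with ∗.  The
-- theorem then reads off P ∗ Q and P^(r) as monics from their coefficients.
module Submission where

open import Defs
open import Algebra.Bundles using (CommutativeRing)
open import Data.Nat using (ℕ; zero; suc; _∸_; _<_; _≤_; z≤n; s≤s)
import Data.Nat.Properties as ℕP
open import Data.Fin as Fin using (Fin; toℕ; fromℕ<; punchIn)
open import Data.Fin.Properties using (toℕ-fromℕ<; toℕ-injective; toℕ<n; punchInᵢ≢i; suc-injective)
open import Data.List using ([]; _∷_)
open import Data.Bool using (true; false)
open import Data.Product using (_×_; Σ; _,_; proj₁; proj₂)
open import Data.Sum using (_⊎_; inj₁; inj₂)
open import Relation.Nullary using (¬_; yes; no)
open import Relation.Binary.Definitions using (tri<; tri≈; tri>)
open import Data.Empty using (⊥-elim)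
open import Relation.Binary.PropositionalEquality as Eq using (_≡_; _≢_)
open import Algebra.Morphism.Structures using (module RingMorphisms)

module PolynomialArithmetic {c ℓ} (R : CommutativeRing c ℓ) where
  open CommutativeRing R
  open Poly R
  open import Algebra.Properties.AbelianGroup +-abelianGroup public
    using () renaming (ε⁻¹≈ε to -0≈0; ⁻¹-involutive to -‿involutive)
  open import Algebra.Properties.CommutativeMonoid.Sum +-commutativeMonoid public using (sum)
  open import Algebra.Properties.CommutativeMonoid.Sum +-commutativeMonoid
    using (sum-cong-≋; sum-replicate-zero; sum-remove)

  sum-cong : ∀ n (f g : Fin n → Carrier) → (∀ j → f j ≈ g j) → sum f ≈ sum g
  sum-cong n f g = sum-cong-≋ {x = f} {y = g}

  sum-zero : ∀ n {f : Fin n → Carrier} → (∀ j → f j ≈ 0#) → sum f ≈ 0#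
  sum-zero n {f} h = trans (sum-cong n f _ h) (sum-replicate-zero n)

  sum-single : ∀ n {f : Fin (suc n) → Carrier} (j₀ : Fin (suc n)) →
               (∀ j → j ≢ j₀ → f j ≈ 0#) → sum f ≈ f j₀
  sum-single n {f} j₀ h = trans (sum-remove {i = j₀} f)
    (trans (+-congˡ (sum-zero n {λ j → f (punchIn j₀ j)} (λ j → h (punchIn j₀ j) (punchInᵢ≢i j₀ j))))
           (+-identityʳ _))

  -- Reflexivity of ≋; the polynomial is explicit since a goal P ≋ Q does not determine it.
  ≋-refl : ∀ P → P ≋ P
  ≋-refl P i = refl

  coeff-+ₚ : ∀ P Q t → coeff (P +ₚ Q) t ≈ coeff P t + coeff Q t
  coeff-+ₚ []      Q       t       = sym (+-identityˡ _)
  coeff-+ₚ (x ∷ P) []      t       = sym (+-identityʳ _)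
  coeff-+ₚ (x ∷ P) (y ∷ Q) zero    = refl
  coeff-+ₚ (x ∷ P) (y ∷ Q) (suc t) = coeff-+ₚ P Q t

  coeff-scale : ∀ x Q t → coeff (scale x Q) t ≈ x * coeff Q t
  coeff-scale x []      t       = sym (zeroʳ x)
  coeff-scale x (y ∷ Q) zero    = refl
  coeff-scale x (y ∷ Q) (suc t) = coeff-scale x Q t

  coeff-neg : ∀ P t → coeff (-ₚ P) t ≈ - coeff P t
  coeff-neg []      t       = sym -0≈0
  coeff-neg (y ∷ Q) zero    = refl
  coeff-neg (y ∷ Q) (suc t) = coeff-neg Q t

  convolution : ∀ P Q t →
    coeff (P *ₚ Q) t ≈ sum (λ (a : Fin (suc t)) → coeff P (toℕ a) * coeff Q (t ∸ toℕ a))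
  convolution []      Q t       = sym (sum-zero (suc t) (λ a → zeroˡ (coeff Q (t ∸ toℕ a))))
  convolution (x ∷ P) Q zero    =
    trans (coeff-+ₚ (scale x Q) (0# ∷ (P *ₚ Q)) 0) (+-congʳ (coeff-scale x Q 0))
  convolution (x ∷ P) Q (suc t) =
    trans (coeff-+ₚ (scale x Q) (0# ∷ (P *ₚ Q)) (suc t))
          (+-cong (coeff-scale x Q (suc t)) (convolution P Q t))

  VanishingTerm : Pol → Pol → ℕ → ℕ → Set ℓ
  VanishingTerm P Q t a = coeff P a ≈ 0# ⊎ coeff Q (t ∸ a) ≈ 0#

  term-zero : ∀ P Q t a → VanishingTerm P Q t a → coeff P a * coeff Q (t ∸ a) ≈ 0#
  term-zero P Q t a (inj₁ e) = trans (*-congʳ e) (zeroˡ _)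
  term-zero P Q t a (inj₂ e) = trans (*-congˡ e) (zeroʳ _)

  coeff-*ₚ-zero : ∀ P Q t → (∀ a → a ≤ t → VanishingTerm P Q t a) → coeff (P *ₚ Q) t ≈ 0#
  coeff-*ₚ-zero P Q t h = trans (convolution P Q t)
    (sum-zero (suc t) (λ a → term-zero P Q t (toℕ a) (h (toℕ a) (ℕP.≤-pred (toℕ<n a)))))

  coeff-*ₚ-single : ∀ P Q t a₀ → a₀ ≤ t →
    (∀ a → a ≤ t → a ≢ a₀ → VanishingTerm P Q t a) →
    coeff (P *ₚ Q) t ≈ coeff P a₀ * coeff Q (t ∸ a₀)
  coeff-*ₚ-single P Q t a₀ a₀≤t h = trans (convolution P Q t)
    (trans (sum-single t j₀ others) (reflexive (Eq.cong (λ a → coeff P a * coeff Q (t ∸ a)) toℕj₀)))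
    where
    j₀ : Fin (suc t)
    j₀ = fromℕ< (s≤s a₀≤t)
    toℕj₀ : toℕ j₀ ≡ a₀
    toℕj₀ = toℕ-fromℕ< (s≤s a₀≤t)
    others : ∀ j → j ≢ j₀ → coeff P (toℕ j) * coeff Q (t ∸ toℕ j) ≈ 0#
    others j j≢j₀ = term-zero P Q t (toℕ j) (h (toℕ j) (ℕP.≤-pred (toℕ<n j))
      (λ e → j≢j₀ (toℕ-injective (Eq.trans e (Eq.sym toℕj₀)))))

  coeff0-*ₚ : ∀ P Q → coeff (P *ₚ Q) 0 ≈ coeff P 0 * coeff Q 0
  coeff0-*ₚ P Q = coeff-*ₚ-single P Q 0 0 z≤n (λ { zero _ ne → ⊥-elim (ne Eq.refl) })

  +ₚ-cong : ∀ P P' Q Q' → P ≋ P' → Q ≋ Q' → (P +ₚ Q) ≋ (P' +ₚ Q')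
  +ₚ-cong P P' Q Q' e f t =
    trans (coeff-+ₚ P Q t) (trans (+-cong (e t) (f t)) (sym (coeff-+ₚ P' Q' t)))

  *ₚ-cong : ∀ P P' Q Q' → P ≋ P' → Q ≋ Q' → (P *ₚ Q) ≋ (P' *ₚ Q')
  *ₚ-cong P P' Q Q' e f t = trans (convolution P Q t)
    (trans (sum-cong (suc t) _ _ (λ a → *-cong (e (toℕ a)) (f (t ∸ toℕ a)))) (sym (convolution P' Q' t)))

  -ₚ-cong : ∀ P P' → P ≋ P' → (-ₚ P) ≋ (-ₚ P')
  -ₚ-cong P P' e t = trans (coeff-neg P t) (trans (-‿cong (e t)) (sym (coeff-neg P' t)))

  signed-cong : ∀ k P P' → P ≋ P' → signed k P ≋ signed k P'
  signed-cong k P P' e with isEven k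
  ... | true  = e
  ... | false = -ₚ-cong P P' e

  coeff-signed : ∀ k P t → coeff (signed k P) t ≈ coeff P t ⊎ coeff (signed k P) t ≈ - coeff P t
  coeff-signed k P t with isEven k
  ... | true  = inj₁ refl
  ... | false = inj₂ (coeff-neg P t)

  signed-zero : ∀ k P t → coeff P t ≈ 0# → coeff (signed k P) t ≈ 0#
  signed-zero k P t e with coeff-signed k P t
  ... | inj₁ s = trans s e
  ... | inj₂ s = trans s (trans (-‿cong e) -0≈0)

  signed-zero⁻¹ : ∀ k P t → coeff (signed k P) t ≈ 0# → coeff P t ≈ 0#
  signed-zero⁻¹ k P t e with coeff-signed k P t
  ... | inj₁ s = trans (sym s) e
  ... | inj₂ s = trans (sym (-‿involutive _)) (trans (-‿cong (trans (sym s) e)) -0≈0)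

  coeff-sumFin : ∀ n F t → coeff (sumFin n F) t ≈ sum (λ j → coeff (F j) t)
  coeff-sumFin zero    F t = refl
  coeff-sumFin (suc n) F t =
    trans (coeff-+ₚ (F Fin.zero) _ t) (+-congˡ (coeff-sumFin n (λ j → F (Fin.suc j)) t))

  sumFin-cong : ∀ n F G → (∀ j → F j ≋ G j) → sumFin n F ≋ sumFin n G
  sumFin-cong zero    F G e = ≋-refl []
  sumFin-cong (suc n) F G e = +ₚ-cong (F Fin.zero) (G Fin.zero) _ _ (e Fin.zero)
    (sumFin-cong n (λ j → F (Fin.suc j)) (λ j → G (Fin.suc j)) (λ j → e (Fin.suc j)))

  minor : ∀ {n} → (Fin (suc n) → Fin (suc n) → Pol) → Fin (suc n) → Fin n → Fin n → Pol
  minor M j i k = M (Fin.suc i) (punchIn j k)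

  laplaceTerm : ∀ {n} → (Fin (suc n) → Fin (suc n) → Pol) → Fin (suc n) → Pol
  laplaceTerm {n} M j = signed (toℕ j) (M Fin.zero j *ₚ det n (minor M j))

  coeff-det-zero : ∀ n M t → (∀ j → coeff (laplaceTerm M j) t ≈ 0#) → coeff (det (suc n) M) t ≈ 0#
  coeff-det-zero n M t h =
    trans (coeff-sumFin (suc n) (laplaceTerm M) t) (sum-zero (suc n) {λ j → coeff (laplaceTerm M j) t} h)

  coeff-det-single : ∀ n M t j₀ → (∀ j → j ≢ j₀ → coeff (laplaceTerm M j) t ≈ 0#) →
                     coeff (det (suc n) M) t ≈ coeff (laplaceTerm M j₀) t
  coeff-det-single n M t j₀ h =
    trans (coeff-sumFin (suc n) (laplaceTerm M) t) (sum-single n {λ j → coeff (laplaceTerm M j) t} j₀ h)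

  det-cong : ∀ n M N → (∀ i j → M i j ≋ N i j) → det n M ≋ det n N
  det-cong zero    M N e = ≋-refl 1ₚ
  det-cong (suc n) M N e = sumFin-cong (suc n) (laplaceTerm M) (laplaceTerm N) (λ j →
    signed-cong (toℕ j) _ _ (*ₚ-cong (M Fin.zero j) (N Fin.zero j) (det n (minor M j)) (det n (minor N j)) (e Fin.zero j)
      (det-cong n (minor M j) (minor N j) (λ i k → e (Fin.suc i) (punchIn j k)))))

module Weights where
  open import Algebra.Properties.CommutativeMonoid.Sum ℕP.+-0-commutativeMonoid public
    using () renaming (sum to total; sum-remove to total-remove)
  open import Algebra.Properties.CommutativeMonoid.Sum ℕP.+-0-commutativeMonoid using (sum-cong-≗)
  open import Data.Nat.Tactic.RingSolver using (solve-∀)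
  open import Data.Nat using (_+_)
  import Data.Nat as ℕ

  total-mono : ∀ n (u w : Fin n → ℕ) → (∀ i → u i ≤ w i) → total u ≤ total w
  total-mono zero    u w h = z≤n
  total-mono (suc n) u w h = ℕP.+-mono-≤ (h Fin.zero) (total-mono n _ _ (λ i → h (Fin.suc i)))

  private
    regroup : ∀ a d x y → (a + d) + (x + y) ≡ (a + x) + (d + y)
    regroup = solve-∀

  split-budget : ∀ {a t} u₀ U → a ≤ t → t + (u₀ + U) ≡ (a + u₀) + ((t ∸ a) + U)
  split-budget {a} {t} u₀ U a≤t =
    Eq.trans (Eq.cong (λ s → s + (u₀ + U)) (Eq.sym (ℕP.m+[n∸m]≡n a≤t))) (regroup a (t ∸ a) u₀ U)

  -- The two degree budgets met in a Laplace expansion: if the entry in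
  -- column j uses degree a and the column weight w is at least a + u₀,
  -- the minor still has the remaining budget.
  minor-budget : ∀ {a t u₀ w U W} → a ≤ t → a + u₀ ≤ w → w + W < t + (u₀ + U) → W < (t ∸ a) + U
  minor-budget {a} {t} {u₀} {w} {U} {W} a≤t le lt = ℕP.+-cancelˡ-< (a + u₀) W ((t ∸ a) + U)
    (ℕP.≤-<-trans (ℕP.+-monoˡ-≤ W le) (Eq.subst (w + W <_) (split-budget u₀ U a≤t) lt))

  minor-budget-strict : ∀ {a t u₀ w U W} → a ≤ t → a + u₀ < w → t + (u₀ + U) ≡ w + W → W < (t ∸ a) + U
  minor-budget-strict {a} {t} {u₀} {w} {U} {W} a≤t lt eq = ℕP.+-cancelˡ-< (a + u₀) W ((t ∸ a) + U)
    (Eq.subst (a + u₀ + W <_) (Eq.trans (Eq.sym eq) (split-budget u₀ U a≤t)) (ℕP.+-monoˡ-< W lt))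

  leading-index : ∀ {a D u U W} → U ≤ W → D + (u + U) ≡ (a + u) + W → a ≤ D
  leading-index {a} {D} {u} {U} {W} U≤W eq = ℕP.+-cancelʳ-≤ u a D (ℕP.+-cancelʳ-≤ U (a + u) (D + u)
    (ℕP.≤-trans (ℕP.+-monoʳ-≤ (a + u) U≤W)
      (ℕP.≤-reflexive (Eq.trans (Eq.sym eq) (Eq.sym (ℕP.+-assoc D u U))))))

  leading-rest : ∀ {a D u U W} → a ≤ D → D + (u + U) ≡ (a + u) + W → (D ∸ a) + U ≡ W
  leading-rest {a} {D} {u} {U} {W} a≤D eq =
    ℕP.+-cancelˡ-≡ (a + u) _ _ (Eq.trans (Eq.sym (split-budget u U a≤D)) eq)

  rowWeight : ℕ → ℕ → ℕ
  rowWeight m x with x ℕP.<? m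
  ... | yes _ = x
  ... | no _  = x ∸ m

  rowWeight-first : ∀ m x → x < m → rowWeight m x ≡ x
  rowWeight-first m x x<m with x ℕP.<? m
  ... | yes _   = Eq.refl
  ... | no  x≮m = ⊥-elim (x≮m x<m)

  rowWeight-second : ∀ m x → ¬ x < m → rowWeight m x ≡ x ∸ m
  rowWeight-second m x x≮m with x ℕP.<? m
  ... | yes x<m = ⊥-elim (x≮m x<m)
  ... | no  _   = Eq.refl

  total-split : ∀ m n (f : ℕ → ℕ) →
                total {m + n} (λ i → f (toℕ i)) ≡ total {m} (λ i → f (toℕ i)) + total {n} (λ i → f (m + toℕ i))
  total-split zero    n f = Eq.refl
  total-split (suc m) n f = Eq.trans (Eq.cong (f 0 +_) (total-split m n (λ x → f (suc x))))
                                     (Eq.sym (ℕP.+-assoc (f 0) _ _))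

  total-shift : ∀ n m (f : Fin n → ℕ) → total (λ i → m + f i) ≡ n ℕ.* m + total f
  total-shift zero    m f = Eq.refl
  total-shift (suc n) m f = Eq.trans (Eq.cong (m + f Fin.zero +_) (total-shift n m (λ i → f (Fin.suc i))))
                                     (shuffle m (f Fin.zero) (n ℕ.* m) _)
    where
    shuffle : ∀ a b c d → (a + b) + (c + d) ≡ (a + c) + (b + d)
    shuffle = solve-∀

  sylvester-weights : ∀ m n → n ℕ.* m + total {m + n} (λ i → rowWeight m (toℕ i)) ≡ total {m + n} toℕ
  sylvester-weights m n = begin
    n ℕ.* m + total {m + n} (λ i → rowWeight m (toℕ i))
      ≡⟨ Eq.cong (n ℕ.* m +_) (total-split m n (rowWeight m)) ⟩
    n ℕ.* m + (total {m} (λ i → rowWeight m (toℕ i)) + total {n} (λ i → rowWeight m (m + toℕ i)))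
      ≡⟨ Eq.cong (λ x → n ℕ.* m + x)
           (Eq.cong₂ _+_ (sum-cong-≗ {x = λ i → rowWeight m (toℕ i)} {y = toℕ} first)
                         (sum-cong-≗ {x = λ i → rowWeight m (m + toℕ i)} {y = toℕ} second)) ⟩
    n ℕ.* m + (total {m} toℕ + total {n} toℕ)
      ≡⟨ shuffle (n ℕ.* m) (total {m} toℕ) (total {n} toℕ) ⟩
    total {m} toℕ + (n ℕ.* m + total {n} toℕ)
      ≡⟨ Eq.cong (total {m} toℕ +_) (Eq.sym (total-shift n m toℕ)) ⟩
    total {m} toℕ + total {n} (λ i → m + toℕ i)
      ≡⟨ Eq.sym (total-split m n (λ x → x)) ⟩
    total {m + n} toℕ ∎
    where
    open Eq.≡-Reasoning
    shuffle : ∀ a b c → a + (b + c) ≡ b + (a + c)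
    shuffle = solve-∀
    first : ∀ (i : Fin m) → rowWeight m (toℕ i) ≡ toℕ i
    first i = rowWeight-first m (toℕ i) (toℕ<n i)
    second : ∀ (i : Fin n) → rowWeight m (m + toℕ i) ≡ toℕ i
    second i = Eq.trans (rowWeight-second m (m + toℕ i) (ℕP.≤⇒≯ (ℕP.m≤m+n m (toℕ i))))
                        (ℕP.m+n∸m≡n m (toℕ i))

module DeterminantDegree {c ℓ} (R : CommutativeRing c ℓ) where
  open CommutativeRing R using (Carrier; _≈_; 0#; 1#; refl; trans; *-cong; *-identityˡ)
  open Poly R
  open PolynomialArithmetic R
  open Weights
  open import Data.Nat using (_+_)
  open import Function using (_∘_)

  DegreeBounded : ∀ n → (Fin n → Fin n → Pol) → (w u : Fin n → ℕ) → Set ℓ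
  DegreeBounded n M w u = ∀ i c t → w c < t + u i → coeff (M i c) t ≈ 0#

  StrictAboveDiagonal : ∀ n → (Fin n → Fin n → Pol) → (w u : Fin n → ℕ) → Set ℓ
  StrictAboveDiagonal n M w u = ∀ i c → toℕ i < toℕ c → ∀ t → w c ≤ t + u i → coeff (M i c) t ≈ 0#

  UnitDiagonal : ∀ n → (Fin n → Fin n → Pol) → (w u : Fin n → ℕ) → Set ℓ
  UnitDiagonal n M w u = ∀ i → u i ≤ w i × coeff (M i i) (w i ∸ u i) ≈ 1#

  minor-bounded : ∀ {n} M w u → DegreeBounded (suc n) M w u →
                  ∀ j → DegreeBounded n (minor M j) (w ∘ punchIn j) (u ∘ Fin.suc)
  minor-bounded M w u b j i k = b (Fin.suc i) (punchIn j k)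

  det-degree : ∀ n M w u → DegreeBounded n M w u →
               ∀ t → total w < t + total u → coeff (det n M) t ≈ 0#
  det-degree zero    M w u b (suc t) _  = refl
  det-degree (suc n) M w u b t       lt = coeff-det-zero n M t λ j →
    signed-zero (toℕ j) _ t (coeff-*ₚ-zero (M Fin.zero j) (det n (minor M j)) t (vanishing j))
    where
    vanishing : ∀ j a → a ≤ t → VanishingTerm (M Fin.zero j) (det n (minor M j)) t a
    vanishing j a a≤t with w j ℕP.<? a + u Fin.zero
    ... | yes p = inj₁ (b Fin.zero j a p)
    ... | no ¬p = inj₂ (det-degree n (minor M j) _ _ (minor-bounded M w u b j) (t ∸ a)
                    (minor-budget a≤t (ℕP.≮⇒≥ ¬p) (Eq.subst (_< t + total u) (total-remove {i = j} w) lt)))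

  -- The coefficient of X^(Σ w - Σ u) in det M is 1: only the diagonal
  -- product reaches that degree.
  det-leading : ∀ n M w u → DegreeBounded n M w u → StrictAboveDiagonal n M w u → UnitDiagonal n M w u →
                ∀ D → D + total u ≡ total w → coeff (det n M) D ≈ 1#
  det-leading zero    M w u b up dg zero eq = refl
  det-leading (suc n) M w u b up dg D    eq =
    trans (coeff-det-single n M D Fin.zero offDiagonal)
    (trans (coeff-*ₚ-single (M Fin.zero Fin.zero) (det n (minor M Fin.zero)) D a₀ a₀≤D diagonalOnly)
    (trans (*-cong (proj₂ (dg Fin.zero)) (det-leading n (minor M Fin.zero) _ _
                      (minor-bounded M w u b Fin.zero) (λ i k i<k → up (Fin.suc i) (Fin.suc k) (s≤s i<k))
                      (dg ∘ Fin.suc) (D ∸ a₀) (leading-rest a₀≤D eq₀)))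
           (*-identityˡ 1#)))
    where
    u₀ = u Fin.zero
    w₀ = w Fin.zero
    a₀ = w₀ ∸ u₀
    w₀≡a₀+u₀ : w₀ ≡ a₀ + u₀
    w₀≡a₀+u₀ = Eq.sym (ℕP.m∸n+n≡m (proj₁ (dg Fin.zero)))
    eq₀ : D + total u ≡ (a₀ + u₀) + total (w ∘ Fin.suc)
    eq₀ = Eq.subst (λ x → D + total u ≡ x + total (w ∘ Fin.suc)) w₀≡a₀+u₀ eq
    a₀≤D : a₀ ≤ D
    a₀≤D = leading-index (total-mono n _ _ (proj₁ ∘ dg ∘ Fin.suc)) eq₀
    offDiagonal : ∀ j → j ≢ Fin.zero → coeff (laplaceTerm M j) D ≈ 0#
    offDiagonal Fin.zero    0≢0 = ⊥-elim (0≢0 Eq.refl)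
    offDiagonal (Fin.suc j) _   =
      signed-zero (toℕ (Fin.suc j)) _ D (coeff-*ₚ-zero (M Fin.zero (Fin.suc j)) _ D vanishing)
      where
      vanishing : ∀ a → a ≤ D → VanishingTerm (M Fin.zero (Fin.suc j)) (det n (minor M (Fin.suc j))) D a
      vanishing a a≤D with w (Fin.suc j) ℕP.≤? a + u₀
      ... | yes p = inj₁ (up Fin.zero (Fin.suc j) (s≤s z≤n) a p)
      ... | no ¬p = inj₂ (det-degree n (minor M (Fin.suc j)) _ _ (minor-bounded M w u b (Fin.suc j)) (D ∸ a)
                      (minor-budget-strict a≤D (ℕP.≰⇒> ¬p) (Eq.trans eq (total-remove {i = Fin.suc j} w))))
    diagonalOnly : ∀ a → a ≤ D → a ≢ a₀ → VanishingTerm (M Fin.zero Fin.zero) (det n (minor M Fin.zero)) D a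
    diagonalOnly a a≤D a≢a₀ with ℕP.<-cmp a a₀
    ... | tri≈ _ a≡a₀ _ = ⊥-elim (a≢a₀ a≡a₀)
    ... | tri> _ _ a₀<a = inj₁ (b Fin.zero Fin.zero a
                            (Eq.subst (_< a + u₀) (Eq.sym w₀≡a₀+u₀) (ℕP.+-monoˡ-< u₀ a₀<a)))
    ... | tri< a<a₀ _ _ = inj₂ (det-degree n (minor M Fin.zero) _ _ (minor-bounded M w u b Fin.zero) (D ∸ a)
                            (minor-budget-strict a≤D
                              (Eq.subst (a + u₀ <_) (Eq.sym w₀≡a₀+u₀) (ℕP.+-monoˡ-< u₀ a<a₀)) eq))

toℕ-punchIn-below : ∀ {n} (j : Fin (suc n)) (c : Fin n) → toℕ c < toℕ j → toℕ (punchIn j c) ≡ toℕ c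
toℕ-punchIn-below (Fin.suc j) Fin.zero    _         = Eq.refl
toℕ-punchIn-below (Fin.suc j) (Fin.suc c) (s≤s c<j) = Eq.cong suc (toℕ-punchIn-below j c c<j)

toℕ-punchIn-above : ∀ {n} (j : Fin (suc n)) (c : Fin n) → toℕ j ≤ toℕ c → toℕ (punchIn j c) ≡ suc (toℕ c)
toℕ-punchIn-above Fin.zero    c           _         = Eq.refl
toℕ-punchIn-above (Fin.suc j) (Fin.suc c) (s≤s j≤c) = Eq.cong suc (toℕ-punchIn-above j c j≤c)

module DeterminantConstantTerm {c ℓ} (R : CommutativeRing c ℓ) (dom : IsIntegralDomain R) where
  open CommutativeRing R
  open Poly R
  open PolynomialArithmetic R
  open IsIntegralDomain dom
  open import Data.Nat using () renaming (_+_ to _+ℕ_)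
  open import Data.Sum using ([_,_]′)

  nonzero-* : ∀ {x y} → ¬ x ≈ 0# → ¬ y ≈ 0# → ¬ x * y ≈ 0#
  nonzero-* x≉0 y≉0 xy≈0 = [ x≉0 , y≉0 ]′ (noZeroDivisors _ _ xy≈0)

  laplaceTerm0-zero : ∀ {n} M j → VanishingTerm (M Fin.zero j) (det n (minor M j)) 0 0 →
                      coeff (laplaceTerm M j) 0 ≈ 0#
  laplaceTerm0-zero {n} M j v = signed-zero (toℕ j) _ 0
    (trans (coeff0-*ₚ (M Fin.zero j) (det n (minor M j))) (term-zero (M Fin.zero j) (det n (minor M j)) 0 0 v))

  det0-pivot : ∀ n M j₀ → (∀ j → j ≢ j₀ → coeff (laplaceTerm M j) 0 ≈ 0#) →
               ¬ coeff (M Fin.zero j₀) 0 ≈ 0# → ¬ coeff (det n (minor M j₀)) 0 ≈ 0# →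
               ¬ coeff (det (suc n) M) 0 ≈ 0#
  det0-pivot n M j₀ others pivot≉0 minor≉0 det≈0 = nonzero-* pivot≉0 minor≉0
    (trans (sym (coeff0-*ₚ (M Fin.zero j₀) (det n (minor M j₀))))
      (signed-zero⁻¹ (toℕ j₀) _ 0 (trans (sym (coeff-det-single n M 0 j₀ others)) det≈0)))

  det0-zeroRow : ∀ n M (i : Fin n) → (∀ c → coeff (M i c) 0 ≈ 0#) → coeff (det n M) 0 ≈ 0#
  det0-zeroRow (suc n) M Fin.zero    row = coeff-det-zero n M 0 (λ j → laplaceTerm0-zero M j (inj₁ (row j)))
  det0-zeroRow (suc n) M (Fin.suc i) row = coeff-det-zero n M 0 (λ j → laplaceTerm0-zero M j
    (inj₂ (det0-zeroRow n (minor M j) i (λ k → row (punchIn j k)))))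

  module _ {p q : Carrier} (p≉0 : ¬ p ≈ 0#) (q≉0 : ¬ q ≈ 0#) where

    ScaledIdentityAt0 : ∀ n → (Fin n → Fin n → Pol) → Set ℓ
    ScaledIdentityAt0 n M = ∀ i c → (c ≡ i → coeff (M i c) 0 ≈ q) × (c ≢ i → coeff (M i c) 0 ≈ 0#)

    det0-scaledIdentity : ∀ n M → ScaledIdentityAt0 n M → ¬ coeff (det n M) 0 ≈ 0#
    det0-scaledIdentity zero    M id = 1≉0
    det0-scaledIdentity (suc n) M id = det0-pivot n M Fin.zero
      (λ j j≢0 → laplaceTerm0-zero M j (inj₁ (proj₂ (id Fin.zero j) j≢0)))
      (λ e → q≉0 (trans (sym (proj₁ (id Fin.zero Fin.zero) Eq.refl)) e))
      (det0-scaledIdentity n (minor M Fin.zero) λ i c →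
        (λ c≡i → proj₁ (id (Fin.suc i) (Fin.suc c)) (Eq.cong Fin.suc c≡i)) ,
        (λ c≢i → proj₂ (id (Fin.suc i) (Fin.suc c)) (λ e → c≢i (suc-injective e))))

    record SylvesterShapeAt0 (m n : ℕ) (M : Fin (m +ℕ n) → Fin (m +ℕ n) → Pol) : Set ℓ where
      field
        qRow : ∀ i c k → toℕ i ≡ m +ℕ k →
               (toℕ c ≡ k → coeff (M i c) 0 ≈ q) × (toℕ c ≢ k → coeff (M i c) 0 ≈ 0#)
        pRow : ∀ i c → toℕ i < m → n ≤ toℕ c →
               (toℕ c ≡ n +ℕ toℕ i → coeff (M i c) 0 ≈ p) × (n +ℕ toℕ i < toℕ c → coeff (M i c) 0 ≈ 0#)
    open SylvesterShapeAt0

    pivotColumn : ∀ m n → Fin (suc (m +ℕ n))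
    pivotColumn m n = fromℕ< (s≤s (ℕP.m≤n+m n m))

    toℕ-pivotColumn : ∀ m n → toℕ (pivotColumn m n) ≡ n
    toℕ-pivotColumn m n = toℕ-fromℕ< (s≤s (ℕP.m≤n+m n m))

    minor-shape : ∀ m n M → SylvesterShapeAt0 (suc m) n M → SylvesterShapeAt0 m n (minor M (pivotColumn m n))
    minor-shape m n M S = record { qRow = qRow′ ; pRow = pRow′ }
      where
      jₙ = pivotColumn m n
      qRow′ : ∀ i c k → toℕ i ≡ m +ℕ k →
              (toℕ c ≡ k → coeff (minor M jₙ i c) 0 ≈ q) × (toℕ c ≢ k → coeff (minor M jₙ i c) 0 ≈ 0#)
      qRow′ i c k i≡m+k with toℕ c ℕP.<? n
      ... | yes c<n = (λ c≡k → proj₁ Q (Eq.trans shift c≡k)) ,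
                      (λ c≢k → proj₂ Q (λ e → c≢k (Eq.trans (Eq.sym shift) e)))
        where
        Q = qRow S (Fin.suc i) (punchIn jₙ c) k (Eq.cong suc i≡m+k)
        shift : toℕ (punchIn jₙ c) ≡ toℕ c
        shift = toℕ-punchIn-below jₙ c (Eq.subst (toℕ c <_) (Eq.sym (toℕ-pivotColumn m n)) c<n)
      ... | no c≮n = (λ c≡k → ⊥-elim (ℕP.<⇒≢ k<c (Eq.sym c≡k))) ,
                     (λ _ → proj₂ Q (λ e → ℕP.<⇒≢ (ℕP.m<n⇒m<1+n k<c) (Eq.sym (Eq.trans (Eq.sym shift) e))))
        where
        Q = qRow S (Fin.suc i) (punchIn jₙ c) k (Eq.cong suc i≡m+k)
        k<c : k < toℕ c
        k<c = ℕP.<-≤-trans (ℕP.+-cancelˡ-< m k n (Eq.subst (_< m +ℕ n) i≡m+k (toℕ<n i))) (ℕP.≮⇒≥ c≮n)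
        shift : toℕ (punchIn jₙ c) ≡ suc (toℕ c)
        shift = toℕ-punchIn-above jₙ c (Eq.subst (_≤ toℕ c) (Eq.sym (toℕ-pivotColumn m n)) (ℕP.≮⇒≥ c≮n))
      pRow′ : ∀ i c → toℕ i < m → n ≤ toℕ c →
              (toℕ c ≡ n +ℕ toℕ i → coeff (minor M jₙ i c) 0 ≈ p) ×
              (n +ℕ toℕ i < toℕ c → coeff (minor M jₙ i c) 0 ≈ 0#)
      pRow′ i c i<m n≤c =
        (λ c≡n+i → proj₁ P (Eq.trans shift (Eq.trans (Eq.cong suc c≡n+i) (Eq.sym (ℕP.+-suc n (toℕ i)))))) ,
        (λ n+i<c → proj₂ P (Eq.subst₂ _<_ (Eq.sym (ℕP.+-suc n (toℕ i))) (Eq.sym shift) (s≤s n+i<c)))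
        where
        shift : toℕ (punchIn jₙ c) ≡ suc (toℕ c)
        shift = toℕ-punchIn-above jₙ c (Eq.subst (_≤ toℕ c) (Eq.sym (toℕ-pivotColumn m n)) n≤c)
        P = pRow S (Fin.suc i) (punchIn jₙ c) (s≤s i<m) (Eq.subst (n ≤_) (Eq.sym shift) (ℕP.m≤n⇒m≤1+n n≤c))

    -- Away from the pivot column every Laplace term has zero constant term:
    -- right of it the entry vanishes, left of it the minor has a zero Q-row.
    off-pivot : ∀ m n M → SylvesterShapeAt0 (suc m) n M →
                ∀ j → j ≢ pivotColumn m n → coeff (laplaceTerm M j) 0 ≈ 0#
    off-pivot m n M S j j≢jₙ with ℕP.<-cmp (toℕ j) n
    ... | tri≈ _ j≡n _  = ⊥-elim (j≢jₙ (toℕ-injective (Eq.trans j≡n (Eq.sym (toℕ-pivotColumn m n)))))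
    ... | tri> _ _ n<j  = laplaceTerm0-zero M j (inj₁ (proj₂ (pRow S Fin.zero j (s≤s z≤n) (ℕP.<⇒≤ n<j))
                            (Eq.subst (_< toℕ j) (Eq.sym (ℕP.+-identityʳ n)) n<j)))
    ... | tri< j<n _ _  = laplaceTerm0-zero M j (inj₂ (det0-zeroRow (m +ℕ n) (minor M j) i₀ λ k →
                            proj₂ (qRow S (Fin.suc i₀) (punchIn j k) (toℕ j) (Eq.cong suc (toℕ-fromℕ< m+j<m+n)))
                                  (λ e → punchInᵢ≢i j k (toℕ-injective e))))
      where
      m+j<m+n = ℕP.+-monoʳ-< m j<n
      i₀ : Fin (m +ℕ n)
      i₀ = fromℕ< m+j<m+n

    det0-sylvesterShape : ∀ m n M → SylvesterShapeAt0 m n M → ¬ coeff (det (m +ℕ n) M) 0 ≈ 0#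
    det0-sylvesterShape zero    n M S = det0-scaledIdentity n M λ i c →
      (λ c≡i → proj₁ (qRow S i c (toℕ i) Eq.refl) (Eq.cong toℕ c≡i)) ,
      (λ c≢i → proj₂ (qRow S i c (toℕ i) Eq.refl) (λ e → c≢i (toℕ-injective e)))
    det0-sylvesterShape (suc m) n M S = det0-pivot (m +ℕ n) M (pivotColumn m n) (off-pivot m n M S)
      (λ e → p≉0 (trans (sym pivot≈p) e))
      (det0-sylvesterShape m n _ (minor-shape m n M S))
      where
      pivot≈p : coeff (M Fin.zero (pivotColumn m n)) 0 ≈ p
      pivot≈p = proj₁ (pRow S Fin.zero (pivotColumn m n) (s≤s z≤n) (ℕP.≤-reflexive (Eq.sym (toℕ-pivotColumn m n))))
                      (Eq.trans (toℕ-pivotColumn m n) (Eq.sym (ℕP.+-identityʳ n)))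

module SparsePolynomials {c ℓ} (R : CommutativeRing c ℓ) (d : ℕ) where
  open CommutativeRing R
  open Poly R
  open PolynomialArithmetic R
  open import Data.Nat.Divisibility using (_∣_; _∣?_; _∣0; ∣m∣n⇒∣m+n)

  Sparse : Pol → Set ℓ
  Sparse P = ∀ t → ¬ d ∣ t → coeff P t ≈ 0#

  +ₚ-sparse : ∀ P Q → Sparse P → Sparse Q → Sparse (P +ₚ Q)
  +ₚ-sparse P Q sP sQ t d∤t = trans (coeff-+ₚ P Q t) (trans (+-cong (sP t d∤t) (sQ t d∤t)) (+-identityʳ 0#))

  -- In Σ p_a q_(t-a) with d ∤ t, d cannot divide both a and t - a.
  *ₚ-sparse : ∀ P Q → Sparse P → Sparse Q → Sparse (P *ₚ Q)
  *ₚ-sparse P Q sP sQ t d∤t = coeff-*ₚ-zero P Q t vanishing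
    where
    vanishing : ∀ a → a ≤ t → VanishingTerm P Q t a
    vanishing a a≤t with d ∣? a | d ∣? (t ∸ a)
    ... | no d∤a | _        = inj₁ (sP a d∤a)
    ... | yes _  | no d∤t-a = inj₂ (sQ (t ∸ a) d∤t-a)
    ... | yes d∣a | yes d∣t-a =
      ⊥-elim (d∤t (Eq.subst (d ∣_) (ℕP.m+[n∸m]≡n a≤t) (∣m∣n⇒∣m+n d∣a d∣t-a)))

  sumFin-sparse : ∀ n F → (∀ j → Sparse (F j)) → Sparse (sumFin n F)
  sumFin-sparse zero    F h t d∤t = refl
  sumFin-sparse (suc n) F h = +ₚ-sparse (F Fin.zero) _ (h Fin.zero) (sumFin-sparse n _ (λ j → h (Fin.suc j)))

  det-sparse : ∀ n M → (∀ i j → Sparse (M i j)) → Sparse (det n M)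
  det-sparse zero    M h zero    d∤0 = ⊥-elim (d∤0 (d ∣0))
  det-sparse zero    M h (suc t) _   = refl
  det-sparse (suc n) M h = sumFin-sparse (suc n) (laplaceTerm M) λ j t d∤t →
    signed-zero (toℕ j) _ t (*ₚ-sparse (M Fin.zero j) (det n (minor M j)) (h Fin.zero j)
      (det-sparse n (minor M j) (λ i k → h (Fin.suc i) (punchIn j k))) t d∤t)

module MorphismOnPolynomials {a ℓa b ℓb} (A : CommutativeRing a ℓa) (B : CommutativeRing b ℓb)
    (φ : CommutativeRing.Carrier A → CommutativeRing.Carrier B) (hom : IsRingMorphism A B φ) where
  private
    module A  = CommutativeRing A
    module PA = Poly A
    module AA = PolynomialArithmetic A
    module H  = RingMorphisms.IsRingHomomorphism hom
  open CommutativeRing B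
  open Poly B
  open PolynomialArithmetic B
  open import Data.Bool using (not)

  φ̂ : PA.Pol → Pol
  φ̂ = φPol A B φ

  coeff-φ̂ : ∀ P t → coeff (φ̂ P) t ≈ φ (PA.coeff P t)
  coeff-φ̂ []      t       = sym H.0#-homo
  coeff-φ̂ (x ∷ P) zero    = refl
  coeff-φ̂ (x ∷ P) (suc t) = coeff-φ̂ P t

  φ̂-cong : ∀ P Q → P PA.≋ Q → φ̂ P ≋ φ̂ Q
  φ̂-cong P Q e t = trans (coeff-φ̂ P t) (trans (H.⟦⟧-cong (e t)) (sym (coeff-φ̂ Q t)))

  φ-sum : ∀ n (f : Fin n → A.Carrier) → φ (AA.sum f) ≈ sum (λ j → φ (f j))
  φ-sum zero    f = H.0#-homo
  φ-sum (suc n) f = trans (H.+-homo _ _) (+-congˡ (φ-sum n (λ j → f (Fin.suc j))))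

  φ̂-+ₚ : ∀ P Q → φ̂ (P PA.+ₚ Q) ≋ (φ̂ P +ₚ φ̂ Q)
  φ̂-+ₚ P Q t = begin
    coeff (φ̂ (P PA.+ₚ Q)) t                ≈⟨ coeff-φ̂ (P PA.+ₚ Q) t ⟩
    φ (PA.coeff (P PA.+ₚ Q) t)             ≈⟨ H.⟦⟧-cong (AA.coeff-+ₚ P Q t) ⟩
    φ (PA.coeff P t A.+ PA.coeff Q t)      ≈⟨ H.+-homo _ _ ⟩
    φ (PA.coeff P t) + φ (PA.coeff Q t)    ≈⟨ +-cong (coeff-φ̂ P t) (coeff-φ̂ Q t) ⟨
    coeff (φ̂ P) t + coeff (φ̂ Q) t          ≈⟨ coeff-+ₚ (φ̂ P) (φ̂ Q) t ⟨
    coeff (φ̂ P +ₚ φ̂ Q) t                   ∎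
    where open import Relation.Binary.Reasoning.Setoid setoid

  φ̂-*ₚ : ∀ P Q → φ̂ (P PA.*ₚ Q) ≋ (φ̂ P *ₚ φ̂ Q)
  φ̂-*ₚ P Q t = begin
    coeff (φ̂ (P PA.*ₚ Q)) t                                   ≈⟨ coeff-φ̂ (P PA.*ₚ Q) t ⟩
    φ (PA.coeff (P PA.*ₚ Q) t)                                ≈⟨ H.⟦⟧-cong (AA.convolution P Q t) ⟩
    φ (AA.sum {suc t} termA)                                  ≈⟨ φ-sum (suc t) termA ⟩
    sum {suc t} (λ a → φ (termA a))                           ≈⟨ sum-cong (suc t) _ _ termwise ⟩
    sum {suc t} (λ a → coeff (φ̂ P) (toℕ a) * coeff (φ̂ Q) (t ∸ toℕ a)) ≈⟨ convolution (φ̂ P) (φ̂ Q) t ⟨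
    coeff (φ̂ P *ₚ φ̂ Q) t                                      ∎
    where
    open import Relation.Binary.Reasoning.Setoid setoid
    termA : Fin (suc t) → A.Carrier
    termA a = PA.coeff P (toℕ a) A.* PA.coeff Q (t ∸ toℕ a)
    termwise : ∀ a → φ (termA a) ≈ coeff (φ̂ P) (toℕ a) * coeff (φ̂ Q) (t ∸ toℕ a)
    termwise a = trans (H.*-homo _ _) (sym (*-cong (coeff-φ̂ P (toℕ a)) (coeff-φ̂ Q (t ∸ toℕ a))))

  φ̂--ₚ : ∀ P → φ̂ (PA.-ₚ P) ≋ (-ₚ φ̂ P)
  φ̂--ₚ P t = trans (coeff-φ̂ (PA.-ₚ P) t) (trans (H.⟦⟧-cong (AA.coeff-neg P t))
    (trans (H.-‿homo _) (sym (trans (coeff-neg (φ̂ P) t) (-‿cong (coeff-φ̂ P t))))))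

  isEven-agrees : ∀ k → PA.isEven k ≡ isEven k
  isEven-agrees zero    = Eq.refl
  isEven-agrees (suc k) = Eq.cong not (isEven-agrees k)

  φ̂-signed : ∀ k P → φ̂ (PA.signed k P) ≋ signed k (φ̂ P)
  φ̂-signed k P with PA.isEven k | isEven k | isEven-agrees k
  ... | true  | .true  | Eq.refl = ≋-refl (φ̂ P)
  ... | false | .false | Eq.refl = φ̂--ₚ P

  φ̂-sumFin : ∀ n F → φ̂ (PA.sumFin n F) ≋ sumFin n (λ j → φ̂ (F j))
  φ̂-sumFin zero    F = ≋-refl []
  φ̂-sumFin (suc n) F t = trans (φ̂-+ₚ (F Fin.zero) (PA.sumFin n (λ j → F (Fin.suc j))) t)
    (+ₚ-cong (φ̂ (F Fin.zero)) (φ̂ (F Fin.zero)) _ (sumFin n (λ j → φ̂ (F (Fin.suc j))))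
      (≋-refl (φ̂ (F Fin.zero))) (φ̂-sumFin n (λ j → F (Fin.suc j))) t)

  φ̂-det : ∀ n M → φ̂ (PA.det n M) ≋ det n (λ i j → φ̂ (M i j))
  φ̂-det zero    M zero    = H.1#-homo
  φ̂-det zero    M (suc t) = refl
  φ̂-det (suc n) M t = trans (φ̂-sumFin (suc n) (AA.laplaceTerm M) t)
    (sumFin-cong (suc n) (λ j → φ̂ (AA.laplaceTerm M j)) (laplaceTerm (λ i j → φ̂ (M i j))) (λ j t′ →
      trans (φ̂-signed (toℕ j) (M Fin.zero j PA.*ₚ PA.det n (AA.minor M j)) t′)
        (signed-cong (toℕ j) _ _ (λ t″ → trans (φ̂-*ₚ (M Fin.zero j) (PA.det n (AA.minor M j)) t″)
          (*ₚ-cong (φ̂ (M Fin.zero j)) (φ̂ (M Fin.zero j))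
                   (φ̂ (PA.det n (AA.minor M j))) (det n (minor (λ i j → φ̂ (M i j)) j))
            (≋-refl (φ̂ (M Fin.zero j))) (φ̂-det n (AA.minor M j)) t″)) t′)) t)

-- The Sylvester matrix S of P ∗ Q = Res_Z(P(Z), Q(X/Z) Z^m), n = deg P, m = deg Q:
-- its first m rows hold the constants p_j, its last n rows the monomials
-- q_t X^t.  Weighting column c by c and row i by its offset, this makes
-- P ∗ Q monic of degree n·m; it is d-sparse whenever Q is.
module StarProduct {c ℓ} (R : CommutativeRing c ℓ) where
  open CommutativeRing R
  open Poly R
  open PolynomialArithmetic R
  open DeterminantDegree R
  open Weights
  open import Data.Nat using () renaming (_+_ to _+ℕ_; _*_ to _*ℕ_)

  band-cases : ∀ h d k c → band h d k c ≡ [] ⊎ (k ≤ c × c ∸ k ≤ d × band h d k c ≡ h (d ∸ (c ∸ k)))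
  band-cases h d k c with k ℕP.≤? c
  ... | no _ = inj₁ Eq.refl
  ... | yes k≤c with (c ∸ k) ℕP.≤? d
  ...   | yes c-k≤d = inj₂ (k≤c , c-k≤d , Eq.refl)
  ...   | no _      = inj₁ Eq.refl

  band-inside : ∀ h d k c → k ≤ c → c ∸ k ≤ d → band h d k c ≡ h (d ∸ (c ∸ k))
  band-inside h d k c k≤c c-k≤d with k ℕP.≤? c
  ... | no k≰c = ⊥-elim (k≰c k≤c)
  ... | yes _ with (c ∸ k) ℕP.≤? d
  ...   | yes _     = Eq.refl
  ...   | no c-k≰d  = ⊥-elim (c-k≰d c-k≤d)

  sylvester-first : ∀ f n g m i c → toℕ i < m → sylvester f n g m i c ≡ band f n (toℕ i) (toℕ c)
  sylvester-first f n g m i c i<m with toℕ i ℕP.<? m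
  ... | yes _   = Eq.refl
  ... | no  i≮m = ⊥-elim (i≮m i<m)

  sylvester-second : ∀ f n g m i c k → toℕ i ≡ m +ℕ k → sylvester f n g m i c ≡ band g m k (toℕ c)
  sylvester-second f n g m i c k i≡m+k with toℕ i ℕP.<? m
  ... | yes i<m = ⊥-elim (ℕP.<⇒≱ i<m (Eq.subst (m ≤_) (Eq.sym i≡m+k) (ℕP.m≤m+n m k)))
  ... | no  _   = Eq.cong (λ x → band g m x (toℕ c)) (Eq.trans (Eq.cong (_∸ m) i≡m+k) (ℕP.m+n∸m≡n m k))

  coeff-monomial-at : ∀ x e → coeff (monomial x e) e ≡ x
  coeff-monomial-at x zero    = Eq.refl
  coeff-monomial-at x (suc e) = coeff-monomial-at x e

  coeff-monomial-off : ∀ x e t → t ≢ e → coeff (monomial x e) t ≈ 0#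
  coeff-monomial-off x zero    zero    t≢e = ⊥-elim (t≢e Eq.refl)
  coeff-monomial-off x zero    (suc t) _   = refl
  coeff-monomial-off x (suc e) zero    _   = refl
  coeff-monomial-off x (suc e) (suc t) t≢e = coeff-monomial-off x e t (λ t≡e → t≢e (Eq.cong suc t≡e))

  coeff-toPol-top : ∀ P → coeff (toPol P) (deg P) ≡ 1#
  coeff-toPol-top []      = Eq.refl
  coeff-toPol-top (x ∷ P) = coeff-toPol-top P

  coeff-toPol-beyond : ∀ P t → deg P < t → coeff (toPol P) t ≡ 0#
  coeff-toPol-beyond []      (suc t) _         = Eq.refl
  coeff-toPol-beyond (x ∷ P) (suc t) (s≤s lt) = coeff-toPol-beyond P t lt

  module _ (P Q : Monic) where
    private
      n = deg P
      m = deg Q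

    pCoeff : ℕ → Pol
    pCoeff j = const (coeff (toPol P) j)

    qCoeff : ℕ → Pol
    qCoeff k = monomial (coeff (toPol Q) (m ∸ k)) (m ∸ k)

    S : Fin (m +ℕ n) → Fin (m +ℕ n) → Pol
    S = sylvester pCoeff n qCoeff m

    first-entry-nonconstant : ∀ i c t → toℕ i < m → coeff (S i c) (suc t) ≈ 0#
    first-entry-nonconstant i c t i<m rewrite sylvester-first pCoeff n qCoeff m i c i<m
      with band-cases pCoeff n (toℕ i) (toℕ c)
    ... | inj₁ e           rewrite e = refl
    ... | inj₂ (_ , _ , e) rewrite e = refl

    first-entry-outside : ∀ i c t → toℕ i < m → toℕ c < toℕ i ⊎ n +ℕ toℕ i < toℕ c → coeff (S i c) t ≈ 0#
    first-entry-outside i c t i<m outside rewrite sylvester-first pCoeff n qCoeff m i c i<m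
      with band-cases pCoeff n (toℕ i) (toℕ c) | outside
    ... | inj₁ e                 | _ rewrite e = refl
    ... | inj₂ (i≤c , _ , _)     | inj₁ c<i    = ⊥-elim (ℕP.<⇒≱ c<i i≤c)
    ... | inj₂ (i≤c , c-i≤n , _) | inj₂ n+i<c  =
      ⊥-elim (ℕP.<⇒≱ n+i<c (Eq.subst (_≤ n +ℕ toℕ i) (ℕP.m∸n+n≡m i≤c) (ℕP.+-monoˡ-≤ (toℕ i) c-i≤n)))

    first-entry-const : ∀ i c → toℕ i < m → toℕ i ≤ toℕ c → toℕ c ∸ toℕ i ≤ n →
                        coeff (S i c) 0 ≡ coeff (toPol P) (n ∸ (toℕ c ∸ toℕ i))
    first-entry-const i c i<m i≤c c-i≤n rewrite sylvester-first pCoeff n qCoeff m i c i<m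
      | band-inside pCoeff n (toℕ i) (toℕ c) i≤c c-i≤n = Eq.refl

    second-entry-off : ∀ i c k t → toℕ i ≡ m +ℕ k → t +ℕ k ≢ toℕ c → coeff (S i c) t ≈ 0#
    second-entry-off i c k t i≡m+k off rewrite sylvester-second pCoeff n qCoeff m i c k i≡m+k
      with band-cases qCoeff m k (toℕ c)
    ... | inj₁ e rewrite e = refl
    ... | inj₂ (k≤c , c-k≤m , e) rewrite e = coeff-monomial-off _ _ t λ t≡ →
      off (Eq.trans (Eq.cong (_+ℕ k) (Eq.trans t≡ (ℕP.m∸[m∸n]≡n c-k≤m))) (ℕP.m∸n+n≡m k≤c))

    qRow-coeff : ∀ k t → coeff (band qCoeff m k (t +ℕ k)) t ≈ coeff (toPol Q) t
    qRow-coeff k t with t ℕP.≤? m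
    ... | yes t≤m rewrite band-inside qCoeff m k (t +ℕ k) (ℕP.m≤n+m k t)
                            (ℕP.≤-trans (ℕP.≤-reflexive (ℕP.m+n∸n≡m t k)) t≤m)
                        | ℕP.m+n∸n≡m t k | ℕP.m∸[m∸n]≡n t≤m = reflexive (coeff-monomial-at _ t)
    ... | no t≰m with band-cases qCoeff m k (t +ℕ k)
    ...   | inj₁ e rewrite e = sym (reflexive (coeff-toPol-beyond Q t (ℕP.≰⇒> t≰m)))
    ...   | inj₂ (_ , t+k-k≤m , _) = ⊥-elim (t≰m (Eq.subst (_≤ m) (ℕP.m+n∸n≡m t k) t+k-k≤m))

    second-entry-on : ∀ i c k t → toℕ i ≡ m +ℕ k → t +ℕ k ≡ toℕ c → coeff (S i c) t ≈ coeff (toPol Q) t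
    second-entry-on i c k t i≡m+k on rewrite sylvester-second pCoeff n qCoeff m i c k i≡m+k =
      Eq.subst (λ x → coeff (band qCoeff m k x) t ≈ coeff (toPol Q) t) on (qRow-coeff k t)

    data RowKind (i : Fin (m +ℕ n)) : Set where
      first  : toℕ i < m → RowKind i
      second : ∀ k → toℕ i ≡ m +ℕ k → RowKind i

    rowKind : ∀ i → RowKind i
    rowKind i with toℕ i ℕP.<? m
    ... | yes i<m = first i<m
    ... | no  i≮m = second (toℕ i ∸ m) (Eq.sym (ℕP.m+[n∸m]≡n (ℕP.≮⇒≥ i≮m)))

    u : Fin (m +ℕ n) → ℕ
    u i = rowWeight m (toℕ i)

    u-second : ∀ i k → toℕ i ≡ m +ℕ k → u i ≡ k
    u-second i k i≡m+k = Eq.trans (rowWeight-second m (toℕ i) i≮m) (Eq.trans (Eq.cong (_∸ m) i≡m+k) (ℕP.m+n∸m≡n m k))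
      where
      i≮m : ¬ toℕ i < m
      i≮m i<m = ℕP.<⇒≱ i<m (Eq.subst (m ≤_) (Eq.sym i≡m+k) (ℕP.m≤m+n m k))

    bounded : DegreeBounded (m +ℕ n) S toℕ u
    bounded i c t c<t+u with rowKind i
    ... | first i<m = first-bounded t (Eq.subst (λ x → toℕ c < t +ℕ x) (rowWeight-first m (toℕ i) i<m) c<t+u)
      where
      first-bounded : ∀ t → toℕ c < t +ℕ toℕ i → coeff (S i c) t ≈ 0#
      first-bounded zero    c<i = first-entry-outside i c 0 i<m (inj₁ c<i)
      first-bounded (suc t) _   = first-entry-nonconstant i c t i<m
    ... | second k i≡m+k = second-entry-off i c k t i≡m+k λ t+k≡c →
      ℕP.<⇒≢ (Eq.subst (λ x → toℕ c < t +ℕ x) (u-second i k i≡m+k) c<t+u) (Eq.sym t+k≡c)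

    strictAbove : StrictAboveDiagonal (m +ℕ n) S toℕ u
    strictAbove i c i<c t c≤t+u with rowKind i
    ... | first i<m = first-strict t (Eq.subst (λ x → toℕ c ≤ t +ℕ x) (rowWeight-first m (toℕ i) i<m) c≤t+u)
      where
      first-strict : ∀ t → toℕ c ≤ t +ℕ toℕ i → coeff (S i c) t ≈ 0#
      first-strict zero    c≤i = ⊥-elim (ℕP.<⇒≱ i<c c≤i)
      first-strict (suc t) _   = first-entry-nonconstant i c t i<m
    ... | second k i≡m+k with (t +ℕ k) ℕP.≟ toℕ c
    ...   | no  off = second-entry-off i c k t i≡m+k off
    ...   | yes on  = trans (second-entry-on i c k t i≡m+k on) (reflexive (coeff-toPol-beyond Q t m<t))
      where
      m<t : m < t
      m<t = ℕP.+-cancelʳ-< k m t (Eq.subst₂ _<_ i≡m+k (Eq.sym on) i<c)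

    unitDiagonal : UnitDiagonal (m +ℕ n) S toℕ u
    unitDiagonal i with rowKind i
    ... | first i<m rewrite rowWeight-first m (toℕ i) i<m = ℕP.≤-refl ,
      Eq.subst (λ x → coeff (S i i) x ≈ 1#) (Eq.sym i-i≡0)
        (reflexive (Eq.trans (first-entry-const i i i<m ℕP.≤-refl (Eq.subst (_≤ n) (Eq.sym i-i≡0) z≤n))
                   (Eq.trans (Eq.cong (λ x → coeff (toPol P) (n ∸ x)) i-i≡0) (coeff-toPol-top P))))
      where
      i-i≡0 = ℕP.n∸n≡0 (toℕ i)
    ... | second k i≡m+k rewrite u-second i k i≡m+k = k≤i ,
      Eq.subst (λ x → coeff (S i i) x ≈ 1#) (Eq.sym i-k≡m)
        (trans (second-entry-on i i k m i≡m+k (Eq.sym i≡m+k)) (reflexive (coeff-toPol-top Q)))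
      where
      k≤i : k ≤ toℕ i
      k≤i = Eq.subst (k ≤_) (Eq.sym i≡m+k) (ℕP.m≤n+m k m)
      i-k≡m : toℕ i ∸ k ≡ m
      i-k≡m = Eq.trans (Eq.cong (_∸ k) i≡m+k) (ℕP.m+n∸n≡m m k)

    star-degree : ∀ t → n *ℕ m < t → coeff (P ∗ Q) t ≈ 0#
    star-degree t nm<t = det-degree (m +ℕ n) S toℕ u bounded t
      (Eq.subst (_< t +ℕ total u) (sylvester-weights m n) (ℕP.+-monoˡ-< (total u) nm<t))

    star-leading : coeff (P ∗ Q) (n *ℕ m) ≈ 1#
    star-leading = det-leading (m +ℕ n) S toℕ u bounded strictAbove unitDiagonal (n *ℕ m) (sylvester-weights m n)

    star-sparse : ∀ d → SparsePolynomials.Sparse R d (toPol Q) → SparsePolynomials.Sparse R d (P ∗ Q)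
    star-sparse d Q-sparse = det-sparse (m +ℕ n) S entry-sparse
      where
      open SparsePolynomials R d
      open import Data.Nat.Divisibility using (_∣_; _∣0)
      entry-sparse : ∀ i c → Sparse (S i c)
      entry-sparse i c t d∤t with rowKind i
      ... | first i<m = first-sparse t d∤t
        where
        first-sparse : ∀ t → ¬ d ∣ t → coeff (S i c) t ≈ 0#
        first-sparse zero    d∤0 = ⊥-elim (d∤0 (d ∣0))
        first-sparse (suc t) _   = first-entry-nonconstant i c t i<m
      ... | second k i≡m+k with (t +ℕ k) ℕP.≟ toℕ c
      ...   | no  off = second-entry-off i c k t i≡m+k off
      ...   | yes on  = trans (second-entry-on i c k t i≡m+k on) (Q-sparse t d∤t)

module StarConstantTerm {c ℓ} (R : CommutativeRing c ℓ) (dom : IsIntegralDomain R) where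
  open CommutativeRing R
  open Poly R
  open StarProduct R
  open DeterminantConstantTerm R dom
  open import Data.Nat using () renaming (_+_ to _+ℕ_)

  star-constant : ∀ P Q → InM P → InM Q → ¬ coeff (P ∗ Q) 0 ≈ 0#
  star-constant P Q p₀≉0 q₀≉0 = det0-sylvesterShape p₀≉0 q₀≉0 (deg Q) (deg P) (S P Q) shape
    where
    n = deg P
    m = deg Q
    shape : SylvesterShapeAt0 p₀≉0 q₀≉0 m n (S P Q)
    shape = record
      { qRow = λ i c k i≡m+k →
          (λ c≡k → second-entry-on P Q i c k 0 i≡m+k (Eq.sym c≡k)) ,
          (λ c≢k → second-entry-off P Q i c k 0 i≡m+k (λ k≡c → c≢k (Eq.sym k≡c)))
      ; pRow = λ i c i<m n≤c →
          (λ c≡n+i → reflexive (p₀-entry i c i<m c≡n+i)) ,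
          (λ n+i<c → first-entry-outside P Q i c 0 i<m (inj₂ n+i<c))
      }
      where
      p₀-entry : ∀ i c → toℕ i < m → toℕ c ≡ n +ℕ toℕ i → coeff (S P Q i c) 0 ≡ at0 P
      p₀-entry i c i<m c≡n+i = begin
        coeff (S P Q i c) 0                        ≡⟨ first-entry-const P Q i c i<m i≤c (ℕP.≤-reflexive c-i≡n) ⟩
        coeff (toPol P) (n ∸ (toℕ c ∸ toℕ i))      ≡⟨ Eq.cong (λ x → coeff (toPol P) (n ∸ x)) c-i≡n ⟩
        coeff (toPol P) (n ∸ n)                    ≡⟨ Eq.cong (coeff (toPol P)) (ℕP.n∸n≡0 n) ⟩
        at0 P                                      ∎
        where
        open Eq.≡-Reasoning
        i≤c : toℕ i ≤ toℕ c
        i≤c = Eq.subst (toℕ i ≤_) (Eq.sym c≡n+i) (ℕP.m≤n+m (toℕ i) n)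
        c-i≡n : toℕ c ∸ toℕ i ≡ n
        c-i≡n = Eq.trans (Eq.cong (_∸ toℕ i) c≡n+i) (ℕP.m+n∸n≡m n (toℕ i))

module StarCongruence {c ℓ} (R : CommutativeRing c ℓ) where
  open CommutativeRing R
  open Poly R
  open PolynomialArithmetic R
  open import Data.Nat using () renaming (_+_ to _+ℕ_)

  starWith : ℕ → ℕ → Monic → Monic → Pol
  starWith n m P Q = Res (λ i → const (coeff (toPol P) i)) n (λ k → monomial (coeff (toPol Q) (m ∸ k)) (m ∸ k)) m

  band-cong : ∀ h h′ d k c → (∀ x → h x ≋ h′ x) → band h d k c ≋ band h′ d k c
  band-cong h h′ d k c e with k ℕP.≤? c
  ... | no _ = ≋-refl []
  ... | yes _ with (c ∸ k) ℕP.≤? d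
  ...   | yes _ = e (d ∸ (c ∸ k))
  ...   | no _  = ≋-refl []

  sylvester-cong : ∀ f f′ n g g′ m → (∀ x → f x ≋ f′ x) → (∀ x → g x ≋ g′ x) →
                   ∀ i c → sylvester f n g m i c ≋ sylvester f′ n g′ m i c
  sylvester-cong f f′ n g g′ m ef eg i c with toℕ i ℕP.<? m
  ... | yes _ = band-cong f f′ n (toℕ i) (toℕ c) ef
  ... | no _  = band-cong g g′ m (toℕ i ∸ m) (toℕ c) eg

  monomial-cong : ∀ x y e → x ≈ y → monomial x e ≋ monomial y e
  monomial-cong x y zero    x≈y zero    = x≈y
  monomial-cong x y zero    x≈y (suc t) = refl
  monomial-cong x y (suc e) x≈y zero    = refl
  monomial-cong x y (suc e) x≈y (suc t) = monomial-cong x y e x≈y t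

  starWith-cong : ∀ n m P P′ Q Q′ → toPol P ≋ toPol P′ → toPol Q ≋ toPol Q′ →
                  starWith n m P Q ≋ starWith n m P′ Q′
  starWith-cong n m P P′ Q Q′ eP eQ = det-cong (m +ℕ n) _ _
    (sylvester-cong _ _ n _ _ m (λ i → λ { zero → eP i ; (suc _) → refl })
                                (λ k → monomial-cong _ _ (m ∸ k) (eQ (m ∸ k))))

  star-cong : ∀ P P′ Q Q′ → deg P ≡ deg P′ → deg Q ≡ deg Q′ →
              toPol P ≋ toPol P′ → toPol Q ≋ toPol Q′ →
              (P ∗ Q) ≋ (P′ ∗ Q′)
  star-cong P P′ Q Q′ dP dQ eP eQ =
    Eq.subst₂ (λ n m → (P ∗ Q) ≋ starWith n m P′ Q′) dP dQ (starWith-cong (deg P) (deg Q) P P′ Q Q′ eP eQ)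

module MorphismOnStar {a ℓa b ℓb} (A : CommutativeRing a ℓa) (B : CommutativeRing b ℓb)
    (φ : CommutativeRing.Carrier A → CommutativeRing.Carrier B) (hom : IsRingMorphism A B φ) where
  private
    module A  = CommutativeRing A
    module PA = Poly A
    module H  = RingMorphisms.IsRingHomomorphism hom
  open CommutativeRing B
  open Poly B
  open PolynomialArithmetic B
  open MorphismOnPolynomials A B φ hom
  open StarCongruence B
  open import Data.List.Properties using (length-map)
  open import Data.Nat using () renaming (_+_ to _+ℕ_)

  φ̂-band : ∀ h d k c → φ̂ (PA.band h d k c) ≡ band (λ x → φ̂ (h x)) d k c
  φ̂-band h d k c with k ℕP.≤? c
  ... | no _ = Eq.refl
  ... | yes _ with (c ∸ k) ℕP.≤? d
  ...   | yes _ = Eq.refl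
  ...   | no _  = Eq.refl

  φ̂-sylvester : ∀ f n g m i c →
    φ̂ (PA.sylvester f n g m i c) ≡ sylvester (λ x → φ̂ (f x)) n (λ x → φ̂ (g x)) m i c
  φ̂-sylvester f n g m i c with toℕ i ℕP.<? m
  ... | yes _ = φ̂-band f n (toℕ i) (toℕ c)
  ... | no _  = φ̂-band g m (toℕ i ∸ m) (toℕ c)

  φ̂-monomial : ∀ x e → φ̂ (PA.monomial x e) ≋ monomial (φ x) e
  φ̂-monomial x zero    zero    = refl
  φ̂-monomial x zero    (suc t) = refl
  φ̂-monomial x (suc e) zero    = H.0#-homo
  φ̂-monomial x (suc e) (suc t) = φ̂-monomial x e t

  coeff-φMonic : ∀ P t → coeff (toPol (φMonic A B φ P)) t ≈ φ (PA.coeff (PA.toPol P) t)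
  coeff-φMonic []      zero    = sym H.1#-homo
  coeff-φMonic []      (suc t) = sym H.0#-homo
  coeff-φMonic (x ∷ P) zero    = refl
  coeff-φMonic (x ∷ P) (suc t) = coeff-φMonic P t

  φ̂-star : ∀ P Q → φ̂ (P PA.∗ Q) ≋ (φMonic A B φ P ∗ φMonic A B φ Q)
  φ̂-star P Q t = trans (φ̂-det (m +ℕ n) SA t) (trans (det-cong (m +ℕ n) _ _ entries t)
    (reflexive (Eq.cong (λ X → coeff X t)
      (Eq.sym (Eq.cong₂ (λ n′ m′ → starWith n′ m′ φP φQ) (length-map φ P) (length-map φ Q))))))
    where
    n = PA.deg P
    m = PA.deg Q
    φP = φMonic A B φ P
    φQ = φMonic A B φ Q
    SA = PA.sylvester (λ i → PA.const (PA.coeff (PA.toPol P) i)) n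
                      (λ k → PA.monomial (PA.coeff (PA.toPol Q) (m ∸ k)) (m ∸ k)) m
    entries : ∀ i c → φ̂ (SA i c) ≋ sylvester (λ i → const (coeff (toPol φP) i)) n
                                             (λ k → monomial (coeff (toPol φQ) (m ∸ k)) (m ∸ k)) m i c
    entries i c t′ = trans (reflexive (Eq.cong (λ X → coeff X t′) (φ̂-sylvester _ n _ m i c)))
      (sylvester-cong _ _ n _ _ m
        (λ j → λ { zero → sym (coeff-φMonic P j) ; (suc _) → refl })
        (λ k s → trans (φ̂-monomial _ (m ∸ k) s) (monomial-cong _ _ (m ∸ k) (sym (coeff-φMonic Q (m ∸ k))) s))
        i c t′)

module MonicNormalForm {c ℓ} (R : CommutativeRing c ℓ) where
  open CommutativeRing R
  open Poly R
  open import Data.List using (replicate; _++_)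
  open import Data.Nat using () renaming (_+_ to _+ℕ_; _*_ to _*ℕ_)
  open import Data.Nat.Divisibility using (_∣_; _∣?_; divides; _∣0; n∣n; ∣m∣n⇒∣m+n)

  monicOf : ℕ → (ℕ → Carrier) → Monic
  monicOf zero    f = []
  monicOf (suc N) f = f 0 ∷ monicOf N (λ i → f (suc i))

  monicOf-agrees : ∀ N f → f N ≈ 1# → (∀ i → N < i → f i ≈ 0#) → ∀ i → coeff (toPol (monicOf N f)) i ≈ f i
  monicOf-agrees zero    f top above zero    = sym top
  monicOf-agrees zero    f top above (suc i) = sym (above (suc i) (s≤s z≤n))
  monicOf-agrees (suc N) f top above zero    = refl
  monicOf-agrees (suc N) f top above (suc i) =
    monicOf-agrees N (λ j → f (suc j)) top (λ j N<j → above (suc j) (s≤s N<j)) i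

  coeff-pad-below : ∀ k L t → t < k → coeff (replicate k 0# ++ L) t ≡ 0#
  coeff-pad-below (suc k) L zero    _         = Eq.refl
  coeff-pad-below (suc k) L (suc t) (s≤s t<k) = coeff-pad-below k L t t<k

  coeff-pad-above : ∀ k L s → coeff (replicate k 0# ++ L) (k +ℕ s) ≡ coeff L s
  coeff-pad-above zero    L s = Eq.refl
  coeff-pad-above (suc k) L s = coeff-pad-above k L s

  module _ (r′ : ℕ) where
    private
      r = suc r′
    open SparsePolynomials R r

    substXr-multiple : ∀ L q → coeff (substXr r L) (q *ℕ r) ≡ coeff L q
    substXr-multiple []       q       = Eq.refl
    substXr-multiple (c ∷ cs) zero    = Eq.refl
    substXr-multiple (c ∷ cs) (suc q) =
      Eq.trans (coeff-pad-above r′ (substXr r cs) (q *ℕ r)) (substXr-multiple cs q)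

    substXr-sparse : ∀ L → Sparse (substXr r L)
    substXr-sparse []       t       _   = refl
    substXr-sparse (c ∷ cs) zero    r∤0 = ⊥-elim (r∤0 (r ∣0))
    substXr-sparse (c ∷ cs) (suc t) r∤t with t ℕP.<? r′
    ... | yes t<r′ = reflexive (coeff-pad-below r′ (substXr r cs) t t<r′)
    ... | no  t≮r′ = trans (reflexive (Eq.trans (Eq.cong (coeff (replicate r′ 0# ++ substXr r cs)) (Eq.sym t≡r′+s))
                                                (coeff-pad-above r′ (substXr r cs) s)))
                           (substXr-sparse cs s (λ r∣s → r∤t
                              (Eq.subst (r ∣_) (Eq.cong suc t≡r′+s) (∣m∣n⇒∣m+n n∣n r∣s))))
      where
      s = t ∸ r′
      t≡r′+s : r′ +ℕ s ≡ t
      t≡r′+s = ℕP.m+[n∸m]≡n (ℕP.≮⇒≥ t≮r′)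

    sparse-ext : ∀ X Y → Sparse X → Sparse Y → (∀ q → coeff X (q *ℕ r) ≈ coeff Y (q *ℕ r)) → X ≋ Y
    sparse-ext X Y sX sY agree t with r ∣? t
    ... | yes (divides q t≡q*r) rewrite t≡q*r = agree q
    ... | no  r∤t               = trans (sX t r∤t) (sym (sY t r∤t))

    power-normalForm : ∀ N X → Sparse X → coeff X (N *ℕ r) ≈ 1# → (∀ t → N *ℕ r < t → coeff X t ≈ 0#) →
                       substXr r (toPol (monicOf N (λ q → coeff X (q *ℕ r)))) ≋ X
    power-normalForm N X sX top above = sparse-ext (substXr r (toPol S)) X (substXr-sparse (toPol S)) sX λ q →
      trans (reflexive (substXr-multiple (toPol S) q))
            (monicOf-agrees N _ top (λ i N<i → above (i *ℕ r) (ℕP.*-monoˡ-< r N<i)) q)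
      where
      S = monicOf N (λ q → coeff X (q *ℕ r))

module XrMinusOne {c ℓ} (R : CommutativeRing c ℓ) where
  open CommutativeRing R
  open Poly R
  open PolynomialArithmetic R using (-‿involutive; -0≈0)
  open SparsePolynomials using (Sparse)
  open MonicNormalForm R using (coeff-pad-below)
  open StarProduct R using (coeff-toPol-beyond)
  open import Data.List using (replicate)
  open import Data.List.Properties using (length-replicate)
  open import Data.Nat.Divisibility using (_∣_; _∣0; n∣n)

  -1≉0 : IsIntegralDomain R → ¬ (- 1#) ≈ 0#
  -1≉0 dom -1≈0 = IsIntegralDomain.1≉0 dom (trans (sym (-‿involutive 1#)) (trans (-‿cong -1≈0) -0≈0))

  deg-Xr-1 : ∀ r′ → deg (Xr-1 (suc r′)) ≡ suc r′
  deg-Xr-1 r′ = Eq.cong suc (length-replicate r′)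

  Xr-1-sparse : ∀ r′ → Sparse R (suc r′) (toPol (Xr-1 (suc r′)))
  Xr-1-sparse r′ zero    r∤0 = ⊥-elim (r∤0 (suc r′ ∣0))
  Xr-1-sparse r′ (suc t) r∤t with ℕP.<-cmp t r′
  ... | tri< t<r′ _ _ = reflexive (coeff-pad-below r′ _ t t<r′)
  ... | tri≈ _ t≡r′ _ = ⊥-elim (r∤t (Eq.subst (λ x → suc r′ ∣ suc x) (Eq.sym t≡r′) n∣n))
  ... | tri> _ _ r′<t = reflexive (coeff-toPol-beyond (replicate r′ 0#) t
                          (Eq.subst (_< t) (Eq.sym (length-replicate r′)) r′<t))

module Theorem {a ℓa b ℓb} (A : CommutativeRing a ℓa) (B : CommutativeRing b ℓb)
    (domA : IsIntegralDomain A) (domB : IsIntegralDomain B)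
    (φ : CommutativeRing.Carrier A → CommutativeRing.Carrier B) (hom : IsRingMorphism A B φ) where
  private
    module A   = CommutativeRing A
    module PA  = Poly A
    module H   = RingMorphisms.IsRingHomomorphism hom
    module SA  = StarProduct A
    module NA  = MonicNormalForm A
    module NB  = MonicNormalForm B
    module XA  = XrMinusOne A
    module XB  = XrMinusOne B
  open CommutativeRing B
  open Poly B
  open MorphismOnPolynomials A B φ hom
  open MorphismOnStar A B φ hom
  open import Data.List using (map; replicate; _++_; [_])
  open import Data.List.Properties using (length-map)
  open import Data.Nat using () renaming (_*_ to _*ℕ_)

  φ[-1]≈-1 : φ (A.- A.1#) ≈ - 1#
  φ[-1]≈-1 = trans (H.-‿homo A.1#) (-‿cong H.1#-homo)

  φ-inM : ∀ P → InMφ A B φ P → InM (φMonic A B φ P)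
  φ-inM P (_ , φp₀≉0) p₀≈0 = φp₀≉0 (trans (sym (coeff-φMonic P 0)) p₀≈0)

  Xr-1-inMφ : ∀ r′ → InMφ A B φ (PA.Xr-1 (suc r′))
  Xr-1-inMφ r′ = XA.-1≉0 domA , λ φ[-1]≈0 → XB.-1≉0 domB (trans (sym φ[-1]≈-1) φ[-1]≈0)

  φ-Xr-1 : ∀ r′ → toPol (φMonic A B φ (PA.Xr-1 (suc r′))) ≋ toPol (Xr-1 (suc r′))
  φ-Xr-1 r′ zero    = φ[-1]≈-1
  φ-Xr-1 r′ (suc t) = φ-zeros r′ t
    where
    φ-zeros : ∀ k t → coeff (map φ (replicate k A.0#) ++ [ 1# ]) t ≈ coeff (replicate k 0# ++ [ 1# ]) t
    φ-zeros zero    t       = refl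
    φ-zeros (suc k) zero    = H.0#-homo
    φ-zeros (suc k) (suc t) = φ-zeros k t

  star-constant-inMφ : ∀ P Q → InMφ A B φ P → InMφ A B φ Q → ∀ x → x A.≈ PA.coeff (P PA.∗ Q) 0 →
                       ¬ x A.≈ A.0# × ¬ φ x ≈ 0#
  star-constant-inMφ P Q hP@(p₀≉0 , _) hQ@(q₀≉0 , _) x x≈c =
    (λ x≈0 → StarConstantTerm.star-constant A domA P Q p₀≉0 q₀≉0 (A.trans (A.sym x≈c) x≈0)) ,
    (λ φx≈0 → StarConstantTerm.star-constant B domB (φMonic A B φ P) (φMonic A B φ Q) (φ-inM P hP) (φ-inM Q hQ)
       (trans (sym (φ̂-star P Q 0)) (trans (coeff-φ̂ (P PA.∗ Q) 0) (trans (H.⟦⟧-cong (A.sym x≈c)) φx≈0))))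

  star-closed : ∀ P Q → InMφ A B φ P → InMφ A B φ Q →
                Σ PA.Monic (λ R → PA.toPol R PA.≋ (P PA.∗ Q) × InMφ A B φ R)
  star-closed P Q hP hQ = R , R≋P∗Q , star-constant-inMφ P Q hP hQ (PA.at0 R) (R≋P∗Q 0)
    where
    R = NA.monicOf (PA.deg P *ℕ PA.deg Q) (PA.coeff (P PA.∗ Q))
    R≋P∗Q : PA.toPol R PA.≋ (P PA.∗ Q)
    R≋P∗Q = NA.monicOf-agrees _ _ (SA.star-leading P Q) (SA.star-degree P Q)

  φ-substXr : ∀ r′ S → substXr (suc r′) (toPol (φMonic A B φ S)) ≋ φ̂ (PA.substXr (suc r′) (PA.toPol S))
  φ-substXr r′ S = NB.sparse-ext r′ (substXr (suc r′) (toPol (φMonic A B φ S)))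
                                    (φ̂ (PA.substXr (suc r′) (PA.toPol S)))
                                 (NB.substXr-sparse r′ (toPol (φMonic A B φ S))) φ̂-sparse λ q →
    trans (reflexive (NB.substXr-multiple r′ (toPol (φMonic A B φ S)) q))
    (trans (coeff-φMonic S q)
    (trans (H.⟦⟧-cong (A.reflexive (Eq.sym (NA.substXr-multiple r′ (PA.toPol S) q))))
           (sym (coeff-φ̂ (PA.substXr (suc r′) (PA.toPol S)) (q *ℕ suc r′)))))
    where
    φ̂-sparse : SparsePolynomials.Sparse B (suc r′) (φ̂ (PA.substXr (suc r′) (PA.toPol S)))
    φ̂-sparse t r∤t = trans (coeff-φ̂ (PA.substXr (suc r′) (PA.toPol S)) t)
                           (trans (H.⟦⟧-cong (NA.substXr-sparse r′ (PA.toPol S) t r∤t)) H.0#-homo)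

  powers : ∀ (r : ℕ) → 1 ≤ r → ∀ P → InMφ A B φ P →
           Σ PA.Monic (λ S → PA.IsPower r P S × InMφ A B φ S × IsPower r (φMonic A B φ P) (φMonic A B φ S))
  powers (suc r′) (s≤s z≤n) P hP = S , S-power , S-inMφ , φS-power
    where
    r = suc r′
    E = PA.Xr-1 r
    n = PA.deg P
    -- P ∗ (X^r - 1) is r-sparse, with leading coefficient 1 in degree n·r.
    S = NA.monicOf n (λ q → PA.coeff (P PA.∗ E) (q *ℕ r))
    S-power : PA.IsPower r P S
    S-power = NA.power-normalForm r′ n (P PA.∗ E) (SA.star-sparse P E r (XA.Xr-1-sparse r′))
      (Eq.subst (λ d → PA.coeff (P PA.∗ E) (n *ℕ d) A.≈ A.1#) (XA.deg-Xr-1 r′) (SA.star-leading P E))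
      (λ t nr<t → SA.star-degree P E t (Eq.subst (λ d → n *ℕ d < t) (Eq.sym (XA.deg-Xr-1 r′)) nr<t))
    S-inMφ : InMφ A B φ S
    S-inMφ = star-constant-inMφ P E hP (Xr-1-inMφ r′) (PA.at0 S)
      (A.trans (A.reflexive (Eq.sym (NA.substXr-multiple r′ (PA.toPol S) 0))) (S-power 0))
    φP = φMonic A B φ P
    φS-power : IsPower r φP (φMonic A B φ S)
    φS-power t = begin
      coeff (substXr r (toPol (φMonic A B φ S))) t   ≈⟨ φ-substXr r′ S t ⟩
      coeff (φ̂ (PA.substXr r (PA.toPol S))) t       ≈⟨ φ̂-cong (PA.substXr r (PA.toPol S)) (P PA.∗ E) S-power t ⟩
      coeff (φ̂ (P PA.∗ E)) t                         ≈⟨ φ̂-star P E t ⟩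
      coeff (φP ∗ φMonic A B φ E) t                  ≈⟨ star-cong φP φP (φMonic A B φ E) (Xr-1 r) Eq.refl deg-φE
                                                          (PolynomialArithmetic.≋-refl B (toPol φP)) (φ-Xr-1 r′) t ⟩
      coeff (φP ∗ Xr-1 r) t                          ∎
      where
      open import Relation.Binary.Reasoning.Setoid setoid
      open StarCongruence B using (star-cong)
      deg-φE : deg (φMonic A B φ E) ≡ deg (Xr-1 r)
      deg-φE = Eq.trans (length-map φ E) (Eq.trans (XA.deg-Xr-1 r′) (Eq.sym (XB.deg-Xr-1 r′)))

mainTheorem12 : ∀ {a ℓa b ℓb} (A : CommutativeRing a ℓa) (B : CommutativeRing b ℓb) →
    IsIntegralDomain A → IsIntegralDomain B →
    (φ : CommutativeRing.Carrier A → CommutativeRing.Carrier B) →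
    IsRingMorphism A B φ →
    InMφ A B φ (Poly.X-1 A)
    × (∀ P Q → InMφ A B φ P → InMφ A B φ Q →
         Σ (Poly.Monic A) (λ R →
           Poly._≋_ A (Poly.toPol A R) (Poly._∗_ A P Q) × InMφ A B φ R))
    × (∀ P → InMφ A B φ P → Poly.InM B (φMonic A B φ P))
    × Poly._≋_ B (Poly.toPol B (φMonic A B φ (Poly.X-1 A))) (Poly.toPol B (Poly.X-1 B))
    × (∀ P Q → InMφ A B φ P → InMφ A B φ Q →
         Poly._≋_ B (φPol A B φ (Poly._∗_ A P Q))
                    (Poly._∗_ B (φMonic A B φ P) (φMonic A B φ Q)))
    × (∀ (r : ℕ) → 1 ≤ r → ∀ P → InMφ A B φ P →
         Σ (Poly.Monic A) (λ S →
           Poly.IsPower A r P S × InMφ A B φ S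
           × Poly.IsPower B r (φMonic A B φ P) (φMonic A B φ S)))
mainTheorem12 A B domA domB φ hom =
  Xr-1-inMφ 0 , star-closed , φ-inM , φ-Xr-1 0 , (λ P Q _ _ → φ̂-star P Q) , powers
  where
  open Theorem A B domA domB φ hom
  open MorphismOnStar A B φ hom using (φ̂-star)
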